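{- Let $p$ be an odd prime, let $k>0$ be an integer, and let $G = C_{2p^k}(S)$ be a circulant graph on $n = 2p^k$ vertices with $\emptyset\neq S\subseteq\{1,\ldots,p^k\}$ (i.e. $G$ has at least one edge). Then $\widetilde{\chi}(\Delta(G)) \neq 0$.
   Context: For $S \subseteq \{1,\ldots,\lfloor n/2\rfloor\}$, the circulant graph $C_n(S)$ is the simple graph with vertex set $\mathbb{Z}_n=\{0,\ldots,n-1\}$ and edge set $\{\{i,j\} : |j-i|_n \in S\}$, where $|k|_n=\min\{|k|, n-|k|\}$. The independence complex $\Delta(G)$ is the simplicial complex whose faces are the independent sets of $G$. If $f_{i-1}$ denotes the number of independent sets of cardinality $i$ (so $f_{ -1}=1$) and $d$ is the maximum cardinality of an independent set, the reduced Euler characteristic is $\widetilde{\chi}(\Delta(G))=\sum_{i=0}^{d}(-1)^{i-1}f_{i-1}$. -}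

module Defs where

open import Data.Bool using (Bool; true; false; _∧_; not; if_then_else_)
open import Data.Nat using (ℕ; zero; suc; _∸_; _⊓_; ∣_-_∣; _≡ᵇ_)
open import Data.Fin using (Fin; toℕ)
open import Data.Fin.Subset using (Subset; _∈_; ∣_∣)
open import Data.Vec using (Vec; []; _∷_; lookup)
open import Data.List using (List; []; _∷_; _++_; map; allFin; upTo; filter; length)
open import Data.Bool.ListAction using (any; all)
open import Data.Integer as ℤ using (ℤ; +_; -_)
open import Relation.Nullary.Decidable using (⌊_⌋)
open import Data.Nat.Properties using (_≟_)

circDist : (n : ℕ) → Fin n → Fin n → ℕ
circDist n i j = ∣ toℕ j - toℕ i ∣ ⊓ (n ∸ ∣ toℕ j - toℕ i ∣)

memᵇ : ℕ → List ℕ → Bool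
memᵇ d S = any (λ s → s ≡ᵇ d) S

adjᵇ : (n : ℕ) → List ℕ → Fin n → Fin n → Bool
adjᵇ n S i j = memᵇ (circDist n i j) S

independentᵇ : (n : ℕ) → List ℕ → Subset n → Bool
independentᵇ n S A =
  all (λ i → all (λ j → not (lookup A i ∧ lookup A j ∧ adjᵇ n S i j)) (allFin n)) (allFin n)

allSubsets : (n : ℕ) → List (Subset n)
allSubsets zero = [] ∷ []
allSubsets (suc n) = map (true ∷_) (allSubsets n) ++ map (false ∷_) (allSubsets n)

-- the faces of the independence complex Δ(C_n(S))
independentSets : (n : ℕ) → List ℕ → List (Subset n)
independentSets n S = filter (λ A → independentᵇ n S A Data.Bool.≟ true) (allSubsets n)

-- f-vector: fShift n S i = f_{i-1} = number of independent sets of cardinality i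
fShift : (n : ℕ) → List ℕ → ℕ → ℕ
fShift n S i = length (filter (λ A → ∣ A ∣ ≟ i) (independentSets n S))

sgn : ℕ → ℤ
sgn zero = - (+ 1)
sgn (suc zero) = + 1
sgn (suc (suc i)) = sgn i

-- reduced Euler characteristic  Σ_{i=0}^{n} (-1)^{i-1} f_{i-1}
-- (summing up to n rather than the independence number d: f_{i-1} = 0 for i > d, and d ≤ n)
sumℤ : List ℤ → ℤ
sumℤ [] = + 0
sumℤ (x ∷ xs) = x ℤ.+ sumℤ xs

redEuler : (n : ℕ) → List ℕ → ℤ
redEuler n S = sumℤ (map (λ i → sgn i ℤ.* (+ fShift n S i)) (upTo (suc n)))

module Submission where

-- Write the reduced Euler characteristic of Δ(C_n(S)) as the sum, over all subsets A of ℤ_n, of the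
-- weight (-1)^(|A|-1) if A is independent and 0 otherwise.  The rotation ρ : i ↦ i + 1 is a graph
-- automorphism, so the weight is ρ-invariant.  For n = 2p^k, let Fix t be the set of subsets fixed by
-- ρ^(2p^t).  The map ρ^(2p^t) permutes Fix (t + 1) with p-th power the identity, so (p being prime)
-- its orbits have size 1 or p, and the sums over Fix (t + 1) and Fix t agree modulo p.  Since
-- Fix k contains every subset, χ̃ is congruent modulo p to the sum over the four subsets fixed by ρ²:
-- ∅ contributes -1, ℤ_n contributes 0 (S contains an edge), and the evens and the odds contribute
-- the same value, 0 or (-1)^(p^k - 1) = 1 because p^k is odd.  So χ̃ ≡ ±1 (mod p), hence χ̃ ≠ 0.

open import Defs
open import Data.Nat using (ℕ; _*_; _^_; _≤_; _<_)
open import Data.Nat.Primality using (Prime)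
open import Data.List using (List; [])
open import Data.List.Relation.Unary.All using (All)
open import Data.Product using (_×_)
open import Data.Integer using (+_)
open import Relation.Binary.PropositionalEquality using (_≡_; _≢_)

open import Algebra.Structures using (IsCommutativeMonoid)
open import Data.Bool as Bool using (Bool; true; false; if_then_else_; not; _∧_; _∨_; T)
import Data.Bool.Properties as Bool
open import Data.Bool.ListAction using (all; and)
open import Data.Empty using (⊥; ⊥-elim)
open import Data.Fin as Fin using (Fin; toℕ; fromℕ<)
import Data.Fin.Properties as Fin
open import Data.Fin.Subset using (Subset; ∣_∣; ∁) renaming (⊥ to ∅)
open import Data.Fin.Subset.Properties using (∣p∣≤n; ∣∁p∣≡n∸∣p∣; ∣⊥∣≡0)
open import Data.Integer as ℤ using (ℤ; _+_; -_)
import Data.Integer.Properties as ℤ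
open import Data.Integer.Tactic.RingSolver using (solve-∀)
open import Data.List using (_∷_; [_]; map; filter; length; foldr; upTo; tabulate; allFin)
import Data.List.Properties as List
open import Data.List.Membership.Propositional using (_∈_; _∉_)
import Data.List.Membership.Propositional.Properties as ∈
open import Data.List.Membership.Propositional.Properties.WithK using (unique∧set⇒bag)
open import Data.List.Relation.Binary.BagAndSetEquality using (∼bag⇒↭)
open import Data.List.Relation.Binary.Permutation.Propositional using (_↭_; ↭⇒↭ₛ)
import Data.List.Relation.Binary.Permutation.Propositional.Properties as ↭
open import Data.List.Relation.Binary.Permutation.Setoid.Properties using (foldr-commMonoid)
open import Data.List.Relation.Unary.All using ([]; _∷_)
import Data.List.Relation.Unary.All as All
import Data.List.Relation.Unary.All.Properties as All
open import Data.List.Relation.Unary.AllPairs using ([]; _∷_)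
open import Data.List.Relation.Unary.Any using (here; there)
open import Data.List.Relation.Unary.Unique.Propositional using (Unique)
import Data.List.Relation.Unary.Unique.Propositional.Properties as Unique
open import Data.Nat as ℕ using (zero; suc; _∸_; _⊓_; ∣_-_∣)
import Data.Nat.Properties as ℕ
open import Data.Nat.Coprimality using (prime⇒coprime; coprime-Bézout)
open import Data.Nat.Divisibility using (_∣_; _∣0; ∣-refl; ∣m∣n⇒∣m+n)
open import Data.Nat.DivMod using (_%_)
import Data.Nat.DivMod as ℕ
open import Data.Nat.GCD using (module Bézout)
open import Data.Nat.ListAction using (sum)
open import Data.Nat.Primality using (prime⇒nonZero; prime⇒irreducible)
open import Data.Product using (∃-syntax; _,_; proj₂)
open import Data.Sum using (_⊎_; inj₁; inj₂)
open import Data.Vec using ([]; _∷_; lookup)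
import Data.Vec as Vec
import Data.Vec.Properties as Vec
open import Function using (id; _∘_; _⇔_; mk⇔; Equivalence)
open import Relation.Binary.Definitions using (DecidableEquality; tri<; tri≈; tri>)
open import Relation.Binary.PropositionalEquality using (refl; sym; trans; cong; cong₂; subst; subst₂; module ≡-Reasoning)
import Relation.Binary.PropositionalEquality as ≡
open import Relation.Nullary using (¬_; ¬?; yes; no; does)
open import Relation.Unary using (Decidable)

sumMap : {X : Set} → (X → ℤ) → List X → ℤ
sumMap w xs = sumℤ (map w xs)

sumℤ≡foldr : (zs : List ℤ) → sumℤ zs ≡ foldr _+_ (+ 0) zs
sumℤ≡foldr []       = refl
sumℤ≡foldr (z ∷ zs) = cong (_+_ z) (sumℤ≡foldr zs)

module _ {X : Set} where

  unique-sameElements⇒↭ : {xs ys : List X} → Unique xs → Unique ys → (∀ {z} → z ∈ xs ⇔ z ∈ ys) → xs ↭ ys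
  unique-sameElements⇒↭ xs! ys! same = ∼bag⇒↭ (unique∧set⇒bag xs! ys! same)

  filter-filter : {P Q : X → Set} (P? : Decidable P) (Q? : Decidable Q) → (∀ {x} → P x → Q x) →
                  (xs : List X) → filter P? (filter Q? xs) ≡ filter P? xs
  filter-filter P? Q? P⇒Q []       = refl
  filter-filter P? Q? P⇒Q (x ∷ xs) with Q? x
  ... | yes _ with P? x
  ...   | yes _  = cong (x ∷_) (filter-filter P? Q? P⇒Q xs)
  ...   | no _   = filter-filter P? Q? P⇒Q xs
  filter-filter P? Q? P⇒Q (x ∷ xs) | no ¬Qx with P? x
  ...   | yes Px = ⊥-elim (¬Qx (P⇒Q Px))
  ...   | no _   = filter-filter P? Q? P⇒Q xs

  sumMap-↭ : (w : X → ℤ) {xs ys : List X} → xs ↭ ys → sumMap w xs ≡ sumMap w ys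
  sumMap-↭ w {xs} {ys} xs↭ys = begin
    sumℤ (map w xs)              ≡⟨ sumℤ≡foldr (map w xs) ⟩
    foldr _+_ (+ 0) (map w xs)
      ≡⟨ foldr-commMonoid (≡.setoid ℤ) ℤ.+-0-isCommutativeMonoid (↭⇒↭ₛ (↭.map⁺ w xs↭ys)) ⟩
    foldr _+_ (+ 0) (map w ys)   ≡⟨ sym (sumℤ≡foldr (map w ys)) ⟩
    sumℤ (map w ys)              ∎
    where open ≡-Reasoning

  sumMap-partition : {P : X → Set} (P? : Decidable P) (w : X → ℤ) (xs : List X) →
    sumMap w xs ≡ sumMap w (filter P? xs) + sumMap w (filter (¬? ∘ P?) xs)
  sumMap-partition P? w []       = refl
  sumMap-partition P? w (x ∷ xs) with P? x
  ... | yes _ = trans (cong (_+_ (w x)) (sumMap-partition P? w xs)) (sym (ℤ.+-assoc (w x) _ _))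
  ... | no _  = trans (cong (_+_ (w x)) (sumMap-partition P? w xs))
                      (exchange (w x) (sumMap w (filter P? xs)) (sumMap w (filter (¬? ∘ P?) xs)))
    where
    exchange : ∀ a b c → a + (b + c) ≡ b + (a + c)
    exchange = solve-∀

  sumMap-filter : {P : X → Set} (P? : Decidable P) (w : X → ℤ) (xs : List X) →
    sumMap w (filter P? xs) ≡ sumMap (λ x → if does (P? x) then w x else + 0) xs
  sumMap-filter P? w []       = refl
  sumMap-filter P? w (x ∷ xs) with does (P? x)
  ... | true  = cong (_+_ (w x)) (sumMap-filter P? w xs)
  ... | false = trans (sumMap-filter P? w xs) (sym (ℤ.+-identityˡ _))

  sumMap-const : (w : X → ℤ) (c : ℤ) {xs : List X} → All (λ x → w x ≡ c) xs → sumMap w xs ≡ + length xs ℤ.* c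
  sumMap-const w c []                      = sym (ℤ.*-zeroˡ c)
  sumMap-const w c {x ∷ xs} (wx≡c ∷ xs≡c) = begin
    w x + sumMap w xs          ≡⟨ cong₂ _+_ wx≡c (sumMap-const w c xs≡c) ⟩
    c + + length xs ℤ.* c      ≡⟨ sym (ℤ.suc-* (+ length xs) c) ⟩
    + suc (length xs) ℤ.* c    ∎
    where open ≡-Reasoning

  sumMap-zero : (w : X → ℤ) {xs : List X} → All (λ x → w x ≡ + 0) xs → sumMap w xs ≡ + 0
  sumMap-zero w {xs} w≡0 = trans (sumMap-const w (+ 0) w≡0) (ℤ.*-zeroʳ (+ length xs))

  sumMap-+ : (v w : X → ℤ) (xs : List X) → sumMap (λ x → v x + w x) xs ≡ sumMap v xs + sumMap w xs
  sumMap-+ v w []       = refl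
  sumMap-+ v w (x ∷ xs) = trans (cong (_+_ (v x + w x)) (sumMap-+ v w xs)) (interchange (v x) (w x) _ _)
    where
    interchange : ∀ a b c d → (a + b) + (c + d) ≡ (a + c) + (b + d)
    interchange = solve-∀

  sumMap-cong : {v w : X → ℤ} → (∀ x → v x ≡ w x) → (xs : List X) → sumMap v xs ≡ sumMap w xs
  sumMap-cong v≗w xs = cong sumℤ (List.map-cong v≗w xs)

count : {X : Set} → (X → ℕ) → List X → ℕ → ℕ
count f xs i = length (filter (λ x → f x ℕ.≟ i) xs)

count-∷ : {X : Set} (f : X → ℕ) (x : X) (xs : List X) (i : ℕ) →
          count f (x ∷ xs) i ≡ count id [ f x ] i ℕ.+ count f xs i
count-∷ f x xs i with f x ℕ.≡ᵇ i
... | true  = refl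
... | false = refl

count-singleton-≢ : {a i : ℕ} → a ≢ i → count id [ a ] i ≡ 0
count-singleton-≢ {i = i} a≢i = cong length (List.filter-reject (ℕ._≟ i) a≢i)

count-singleton-≡ : (a : ℕ) → count id [ a ] a ≡ 1
count-singleton-≡ a = cong length (List.filter-accept (ℕ._≟ a) refl)

-- count id [ a ] is the Kronecker delta at a.
sumMap-δ : (g : ℕ → ℤ) {a : ℕ} {is : List ℕ} → Unique is → a ∈ is →
           sumMap (λ i → g i ℤ.* + count id [ a ] i) is ≡ g a
sumMap-δ g {a} {_ ∷ is} (a∉is ∷ _) (here refl) = begin
  g a ℤ.* + count id [ a ] a + sumMap δ-term is
    ≡⟨ cong₂ _+_ (cong (λ c → g a ℤ.* + c) (count-singleton-≡ a)) rest≡0 ⟩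
  g a ℤ.* + 1 + + 0                               ≡⟨ ℤ.+-identityʳ _ ⟩
  g a ℤ.* + 1                                     ≡⟨ ℤ.*-identityʳ (g a) ⟩
  g a                                             ∎
  where
  open ≡-Reasoning
  δ-term : ℕ → ℤ
  δ-term i = g i ℤ.* + count id [ a ] i
  rest≡0 : sumMap δ-term is ≡ + 0
  rest≡0 = sumMap-zero δ-term (All.map (λ {i} a≢i → trans (cong (λ c → g i ℤ.* + c) (count-singleton-≢ a≢i))
                                                         (ℤ.*-zeroʳ (g i)))
                                       a∉is)
sumMap-δ g {a} {i ∷ is} (i∉is ∷ is!) (there a∈is) = begin
  g i ℤ.* + count id [ a ] i + sumMap _ is
    ≡⟨ cong₂ _+_ (cong (λ c → g i ℤ.* + c) (count-singleton-≢ a≢i)) (sumMap-δ g is! a∈is) ⟩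
  g i ℤ.* + 0 + g a                          ≡⟨ cong (_+ g a) (ℤ.*-zeroʳ (g i)) ⟩
  + 0 + g a                                  ≡⟨ ℤ.+-identityˡ (g a) ⟩
  g a                                        ∎
  where
  open ≡-Reasoning
  a≢i : a ≢ i
  a≢i a≡i = All.lookup i∉is a∈is (sym a≡i)

sumMap-fibres : {X : Set} (f : X → ℕ) (g : ℕ → ℤ) (N : ℕ) (xs : List X) → All (λ x → f x < N) xs →
                sumMap (λ i → g i ℤ.* + count f xs i) (upTo N) ≡ sumMap (g ∘ f) xs
sumMap-fibres f g N []       []             = sumMap-zero _ {upTo N} (All.tabulate (λ {i} _ → ℤ.*-zeroʳ (g i)))
sumMap-fibres f g N (x ∷ xs) (fx<N ∷ xs<N) = begin
  sumMap (λ i → g i ℤ.* + count f (x ∷ xs) i) (upTo N)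
    ≡⟨ sumMap-cong split (upTo N) ⟩
  sumMap (λ i → g i ℤ.* + count id [ f x ] i + g i ℤ.* + count f xs i) (upTo N)
    ≡⟨ sumMap-+ _ _ (upTo N) ⟩
  sumMap (λ i → g i ℤ.* + count id [ f x ] i) (upTo N) + sumMap (λ i → g i ℤ.* + count f xs i) (upTo N)
    ≡⟨ cong₂ _+_ (sumMap-δ g (Unique.upTo⁺ N) (∈.∈-upTo⁺ fx<N)) (sumMap-fibres f g N xs xs<N) ⟩
  g (f x) + sumMap (g ∘ f) xs
    ∎
  where
  open ≡-Reasoning
  split : ∀ i → g i ℤ.* + count f (x ∷ xs) i ≡ g i ℤ.* + count id [ f x ] i + g i ℤ.* + count f xs i
  split i = begin
    g i ℤ.* + count f (x ∷ xs) i                          ≡⟨ cong (λ c → g i ℤ.* + c) (count-∷ f x xs i) ⟩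
    g i ℤ.* + (count id [ f x ] i ℕ.+ count f xs i)        ≡⟨ cong (g i ℤ.*_) (ℤ.pos-+ (count id [ f x ] i) _) ⟩
    g i ℤ.* (+ count id [ f x ] i + + count f xs i)        ≡⟨ ℤ.*-distribˡ-+ (g i) _ _ ⟩
    g i ℤ.* + count id [ f x ] i + g i ℤ.* + count f xs i  ∎

∈-allSubsets : ∀ {n} (A : Subset n) → A ∈ allSubsets n
∈-allSubsets []                  = here refl
∈-allSubsets (true ∷ A)          = ∈.∈-++⁺ˡ (∈.∈-map⁺ (true ∷_) (∈-allSubsets A))
∈-allSubsets {suc n} (false ∷ A) =
  ∈.∈-++⁺ʳ (map (true ∷_) (allSubsets n)) (∈.∈-map⁺ (false ∷_) (∈-allSubsets A))

allSubsets-unique : ∀ n → Unique (allSubsets n)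
allSubsets-unique zero    = [] ∷ []
allSubsets-unique (suc n) = Unique.++⁺ (Unique.map⁺ Vec.∷-injectiveʳ (allSubsets-unique n))
                                       (Unique.map⁺ Vec.∷-injectiveʳ (allSubsets-unique n)) disjoint
  where
  disjoint : ∀ {A} → A ∈ map (true ∷_) (allSubsets n) × A ∈ map (false ∷_) (allSubsets n) → ⊥
  disjoint (A∈true , A∈false) with ∈.∈-map⁻ (true ∷_) A∈true | ∈.∈-map⁻ (false ∷_) A∈false
  ... | _ , _ , refl | _ , _ , ()

weight : (n : ℕ) → List ℕ → Subset n → ℤ
weight n S A = if independentᵇ n S A then sgn ∣ A ∣ else + 0

redEuler≡sumMap-weight : (n : ℕ) (S : List ℕ) → redEuler n S ≡ sumMap (weight n S) (allSubsets n)
redEuler≡sumMap-weight n S = begin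
  redEuler n S
    ≡⟨ sumMap-fibres ∣_∣ sgn (suc n) (independentSets n S) (All.tabulate (λ {A} _ → ℕ.s≤s (∣p∣≤n A))) ⟩
  sumMap (sgn ∘ ∣_∣) (independentSets n S)
    ≡⟨ sumMap-filter (λ A → independentᵇ n S A Bool.≟ true) (sgn ∘ ∣_∣) (allSubsets n) ⟩
  sumMap (λ A → if does (independentᵇ n S A Bool.≟ true) then sgn ∣ A ∣ else + 0) (allSubsets n)
    ≡⟨ sumMap-cong (λ A → cong (if_then sgn ∣ A ∣ else + 0) (does-≟-true (independentᵇ n S A))) (allSubsets n) ⟩
  sumMap (weight n S) (allSubsets n)
    ∎
  where
  open ≡-Reasoning
  does-≟-true : (b : Bool) → does (b Bool.≟ true) ≡ b
  does-≟-true true  = refl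
  does-≟-true false = refl

compatibleᵇ : (n : ℕ) → List ℕ → Subset n → Fin n → Fin n → Bool
compatibleᵇ n S A i j = not (lookup A i ∧ lookup A j ∧ adjᵇ n S i j)

module _ {n : ℕ} (S : List ℕ) where

  independentᵇ⇒compatibleᵇ : ∀ A → T (independentᵇ n S A) → ∀ i j → T (compatibleᵇ n S A i j)
  independentᵇ⇒compatibleᵇ A independent i j =
    All.lookup (All.all⁺ (compatibleᵇ n S A i) (allFin n)
                          (All.lookup (All.all⁺ _ (allFin n) independent) (∈.∈-allFin i)))
               (∈.∈-allFin j)

  compatibleᵇ⇒independentᵇ : ∀ A → (∀ i j → T (compatibleᵇ n S A i j)) → T (independentᵇ n S A)
  compatibleᵇ⇒independentᵇ A compatible =
    All.all⁻ _ (All.tabulate⁺ (λ i → All.all⁻ (compatibleᵇ n S A i) (All.tabulate⁺ (compatible i))))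

  empty-independent : ∀ A → (∀ i → lookup A i ≡ false) → independentᵇ n S A ≡ true
  empty-independent A A≡∅ = Equivalence.to Bool.T-≡ (compatibleᵇ⇒independentᵇ A compatible)
    where
    compatible : ∀ i j → T (compatibleᵇ n S A i j)
    compatible i j rewrite A≡∅ i = _

  adjacent-not-independent : ∀ A i j → lookup A i ≡ true → lookup A j ≡ true → adjᵇ n S i j ≡ true →
                             independentᵇ n S A ≡ false
  adjacent-not-independent A i j i∈A j∈A i~j with independentᵇ n S A in independent
  ... | false = refl
  ... | true  = ⊥-elim (subst (λ b → T (not b)) (cong₂ _∧_ i∈A (cong₂ _∧_ j∈A i~j))
                              (independentᵇ⇒compatibleᵇ A (Equivalence.from Bool.T-≡ independent) i j))

infix 4 _≡_mod_

record _≡_mod_ (a b : ℤ) (m : ℕ) : Set where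
  constructor congruent
  field
    quotient : ℤ
    equation : a ≡ b + + m ℤ.* quotient

module _ {m : ℕ} where

  ≡mod-refl : ∀ {a} → a ≡ a mod m
  ≡mod-refl {a} = congruent (+ 0) (sym (trans (cong (_+_ a) (ℤ.*-zeroʳ (+ m))) (ℤ.+-identityʳ a)))

  ≡mod-trans : ∀ {a b c} → a ≡ b mod m → b ≡ c mod m → a ≡ c mod m
  ≡mod-trans {c = c} (congruent q a≡b+mq) (congruent r b≡c+mr) =
    congruent (r + q) (trans a≡b+mq (trans (cong (_+ + m ℤ.* q) b≡c+mr) (regroup c (+ m) q r)))
    where
    regroup : ∀ c m q r → c + m ℤ.* r + m ℤ.* q ≡ c + m ℤ.* (r + q)
    regroup = solve-∀

  ≡mod-+ˡ : ∀ c {a b} → a ≡ b mod m → c + a ≡ c + b mod m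
  ≡mod-+ˡ c {b = b} (congruent q a≡b+mq) = congruent q (trans (cong (_+_ c) a≡b+mq) (sym (ℤ.+-assoc c b _)))

  ≡mod-+-multiple : ∀ c {a b} → a ≡ b mod m → + m ℤ.* c + a ≡ b mod m
  ≡mod-+-multiple c {b = b} (congruent q a≡b+mq) =
    congruent (c + q) (trans (cong (_+_ (+ m ℤ.* c)) a≡b+mq) (regroup (+ m) b c q))
    where
    regroup : ∀ m b c q → m ℤ.* c + (b + m ℤ.* q) ≡ b + m ℤ.* (c + q)
    regroup = solve-∀

  ≡mod-unit⇒≢0 : ∀ {a b} → a ≡ b mod m → ℤ.∣ b ∣ ≡ 1 → 1 < m → a ≢ + 0
  ≡mod-unit⇒≢0 {b = b} (congruent c a≡b+mc) ∣b∣≡1 1<m a≡0 = ℕ.<-irrefl (sym m≡1) 1<m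
    where
    b≡-mc : b ≡ - (+ m ℤ.* c)
    b≡-mc = trans (cancel b (+ m ℤ.* c))
                  (trans (cong (_+ - (+ m ℤ.* c)) (trans (sym a≡b+mc) a≡0)) (ℤ.+-identityˡ (- (+ m ℤ.* c))))
      where
      cancel : ∀ b d → b ≡ (b + d) + - d
      cancel = solve-∀
    m≡1 : m ≡ 1
    m≡1 = ℕ.m*n≡1⇒m≡1 m ℤ.∣ c ∣ (begin
      m * ℤ.∣ c ∣             ≡⟨ sym (ℤ.abs-* (+ m) c) ⟩
      ℤ.∣ + m ℤ.* c ∣         ≡⟨ sym (ℤ.∣-i∣≡∣i∣ (+ m ℤ.* c)) ⟩
      ℤ.∣ - (+ m ℤ.* c) ∣     ≡⟨ cong ℤ.∣_∣ (sym b≡-mc) ⟩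
      ℤ.∣ b ∣                 ≡⟨ ∣b∣≡1 ⟩
      1                       ∎)
      where open ≡-Reasoning

module Iteration {X : Set} where

  open import Function.Endo.Propositional X public using () renaming (_^_ to _∘ⁿ_)
  open import Function.Endo.Propositional X using (^-homo; ∘-id-monoid)
  open import Algebra.Properties.Monoid.Mult ∘-id-monoid using (×-assocˡ)

  ∘ⁿ-+ : (f : X → X) (m n : ℕ) (x : X) → (f ∘ⁿ (m ℕ.+ n)) x ≡ (f ∘ⁿ m) ((f ∘ⁿ n) x)
  ∘ⁿ-+ f m n x = cong (λ g → g x) (^-homo f m n)

  ∘ⁿ-* : (f : X → X) (m n : ℕ) (x : X) → (f ∘ⁿ (m * n)) x ≡ ((f ∘ⁿ n) ∘ⁿ m) x
  ∘ⁿ-* f m n x = cong (λ g → g x) (sym (×-assocˡ f m n))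

  ∘ⁿ-comm : (f : X → X) (m n : ℕ) (x : X) → (f ∘ⁿ m) ((f ∘ⁿ n) x) ≡ (f ∘ⁿ n) ((f ∘ⁿ m) x)
  ∘ⁿ-comm f m n x = begin
    (f ∘ⁿ m) ((f ∘ⁿ n) x)   ≡⟨ sym (∘ⁿ-+ f m n x) ⟩
    (f ∘ⁿ (m ℕ.+ n)) x      ≡⟨ cong (λ e → (f ∘ⁿ e) x) (ℕ.+-comm m n) ⟩
    (f ∘ⁿ (n ℕ.+ m)) x      ≡⟨ ∘ⁿ-+ f n m x ⟩
    (f ∘ⁿ n) ((f ∘ⁿ m) x)   ∎
    where open ≡-Reasoning

  ∘ⁿ-fixed : (f : X → X) (n : ℕ) {x : X} → f x ≡ x → (f ∘ⁿ n) x ≡ x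
  ∘ⁿ-fixed f zero    fx≡x = refl
  ∘ⁿ-fixed f (suc n) fx≡x = trans (cong f (∘ⁿ-fixed f n fx≡x)) fx≡x

  ∘ⁿ-fixed-* : (f : X → X) (m n : ℕ) {x : X} → (f ∘ⁿ n) x ≡ x → (f ∘ⁿ (m * n)) x ≡ x
  ∘ⁿ-fixed-* f m n fⁿx≡x = trans (∘ⁿ-* f m n _) (∘ⁿ-fixed (f ∘ⁿ n) m fⁿx≡x)

open Iteration public

-- Orbits of prime period

module Orbits {X : Set} (_≟_ : DecidableEquality X) (σ : X → X) {p : ℕ} (p-prime : Prime p) where

  open import Data.List.Membership.DecPropositional _≟_ using (_∈?_)

  instance
    p-nonZero : ℕ.NonZero p
    p-nonZero = prime⇒nonZero p-prime

  0<p : 0 < p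
  0<p = ℕ.>-nonZero⁻¹ p

  Fixed : X → Set
  Fixed x = σ x ≡ x

  fixed? : Decidable Fixed
  fixed? x = σ x ≟ x

  Periodic : X → Set
  Periodic x = (σ ∘ⁿ p) x ≡ x

  fixed-of-coprime-period : ∀ d {y} .{{_ : ℕ.NonZero d}} → d < p → (σ ∘ⁿ d) y ≡ y → Periodic y → Fixed y
  fixed-of-coprime-period d {y} d<p σᵈy≡y σᵖy≡y with coprime-Bézout (prime⇒coprime p-prime d<p)
  ... | Bézout.+- a b 1+bd≡ap = begin
    σ y                      ≡⟨ cong σ (sym (∘ⁿ-fixed-* σ b d σᵈy≡y)) ⟩
    (σ ∘ⁿ suc (b * d)) y     ≡⟨ cong (λ e → (σ ∘ⁿ e) y) 1+bd≡ap ⟩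
    (σ ∘ⁿ (a * p)) y         ≡⟨ ∘ⁿ-fixed-* σ a p σᵖy≡y ⟩
    y                        ∎
    where open ≡-Reasoning
  ... | Bézout.-+ a b 1+ap≡bd = begin
    σ y                      ≡⟨ cong σ (sym (∘ⁿ-fixed-* σ a p σᵖy≡y)) ⟩
    (σ ∘ⁿ suc (a * p)) y     ≡⟨ cong (λ e → (σ ∘ⁿ e) y) 1+ap≡bd ⟩
    (σ ∘ⁿ (b * d)) y         ≡⟨ ∘ⁿ-fixed-* σ b d σᵈy≡y ⟩
    y                        ∎
    where open ≡-Reasoning

  fixed-of-fixed-iterate : ∀ {x} k → k ≤ p → Periodic x → Fixed ((σ ∘ⁿ k) x) → Fixed x
  fixed-of-fixed-iterate {x} k k≤p σᵖx≡x σᵏx-fixed = subst Fixed (sym x≡σᵏx) σᵏx-fixed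
    where
    x≡σᵏx : x ≡ (σ ∘ⁿ k) x
    x≡σᵏx = begin
      x                              ≡⟨ sym σᵖx≡x ⟩
      (σ ∘ⁿ p) x                     ≡⟨ cong (λ e → (σ ∘ⁿ e) x) (sym (ℕ.m∸n+n≡m k≤p)) ⟩
      (σ ∘ⁿ (p ∸ k ℕ.+ k)) x         ≡⟨ ∘ⁿ-+ σ (p ∸ k) k x ⟩
      (σ ∘ⁿ (p ∸ k)) ((σ ∘ⁿ k) x)    ≡⟨ ∘ⁿ-fixed σ (p ∸ k) σᵏx-fixed ⟩
      (σ ∘ⁿ k) x                     ∎
      where open ≡-Reasoning

  σᵖ⁻¹∘σ : ∀ {z} → Periodic z → (σ ∘ⁿ (p ∸ 1)) (σ z) ≡ z
  σᵖ⁻¹∘σ {z} σᵖz≡z = begin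
    (σ ∘ⁿ (p ∸ 1)) (σ z)      ≡⟨ sym (∘ⁿ-+ σ (p ∸ 1) 1 z) ⟩
    (σ ∘ⁿ (p ∸ 1 ℕ.+ 1)) z    ≡⟨ cong (λ e → (σ ∘ⁿ e) z) (ℕ.m∸n+n≡m 0<p) ⟩
    (σ ∘ⁿ p) z                ≡⟨ σᵖz≡z ⟩
    z                         ∎
    where open ≡-Reasoning

  orbit : X → List X
  orbit x = tabulate (λ (i : Fin p) → (σ ∘ⁿ toℕ i) x)

  iterates-distinct : ∀ {x i j} → Periodic x → ¬ Fixed x → i < j → j < p → (σ ∘ⁿ i) x ≢ (σ ∘ⁿ j) x
  iterates-distinct {x} {i} {j} σᵖx≡x x-moves i<j j<p σⁱx≡σʲx =
    x-moves (fixed-of-fixed-iterate i (ℕ.<⇒≤ (ℕ.<-trans i<j j<p)) σᵖx≡x y-fixed)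
    where
    y = (σ ∘ⁿ i) x
    instance
      j∸i-nonZero : ℕ.NonZero (j ∸ i)
      j∸i-nonZero = ℕ.>-nonZero (ℕ.m<n⇒0<n∸m i<j)
    σʲ⁻ⁱy≡y : (σ ∘ⁿ (j ∸ i)) y ≡ y
    σʲ⁻ⁱy≡y = begin
      (σ ∘ⁿ (j ∸ i)) y         ≡⟨ sym (∘ⁿ-+ σ (j ∸ i) i x) ⟩
      (σ ∘ⁿ (j ∸ i ℕ.+ i)) x   ≡⟨ cong (λ e → (σ ∘ⁿ e) x) (ℕ.m∸n+n≡m (ℕ.<⇒≤ i<j)) ⟩
      (σ ∘ⁿ j) x               ≡⟨ sym σⁱx≡σʲx ⟩
      y                        ∎
      where open ≡-Reasoning
    y-fixed : Fixed y
    y-fixed = fixed-of-coprime-period (j ∸ i) (ℕ.≤-<-trans (ℕ.m∸n≤m j i) j<p) σʲ⁻ⁱy≡y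
                                      (trans (∘ⁿ-comm σ p i x) (cong (σ ∘ⁿ i) σᵖx≡x))

  orbit-unique : ∀ {x} → Periodic x → ¬ Fixed x → Unique (orbit x)
  orbit-unique {x} σᵖx≡x x-moves = Unique.tabulate⁺ injective
    where
    injective : ∀ {i j : Fin p} → (σ ∘ⁿ toℕ i) x ≡ (σ ∘ⁿ toℕ j) x → i ≡ j
    injective {i} {j} σⁱx≡σʲx with ℕ.<-cmp (toℕ i) (toℕ j)
    ... | tri< i<j _ _ = ⊥-elim (iterates-distinct σᵖx≡x x-moves i<j (Fin.toℕ<n j) σⁱx≡σʲx)
    ... | tri≈ _ i≡j _ = Fin.toℕ-injective i≡j
    ... | tri> _ _ j<i = ⊥-elim (iterates-distinct σᵖx≡x x-moves j<i (Fin.toℕ<n i) (sym σⁱx≡σʲx))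

  ∈-orbit⁺ : ∀ {x k} → k < p → (σ ∘ⁿ k) x ∈ orbit x
  ∈-orbit⁺ {x} {k} k<p =
    subst (λ e → (σ ∘ⁿ e) x ∈ orbit x) (Fin.toℕ-fromℕ< k<p) (∈.∈-tabulate⁺ (fromℕ< k<p))

  ∈-orbit⁻ : ∀ {x z} → z ∈ orbit x → ∃[ k ] k < p × z ≡ (σ ∘ⁿ k) x
  ∈-orbit⁻ z∈orbit with ∈.∈-tabulate⁻ z∈orbit
  ... | i , z≡σⁱx = toℕ i , Fin.toℕ<n i , z≡σⁱx

  orbit-closed : ∀ {x z} → Periodic x → z ∈ orbit x → σ z ∈ orbit x
  orbit-closed {x} σᵖx≡x z∈orbit with ∈-orbit⁻ z∈orbit
  ... | k , k<p , refl with ℕ.m≤n⇒m<n∨m≡n k<p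
  ...   | inj₁ 1+k<p = ∈-orbit⁺ 1+k<p
  ...   | inj₂ 1+k≡p =
    subst (_∈ orbit x) (sym (trans (cong (λ e → (σ ∘ⁿ e) x) 1+k≡p) σᵖx≡x)) (∈-orbit⁺ 0<p)

  orbit-closed-∘ⁿ : ∀ {x z} j → Periodic x → z ∈ orbit x → (σ ∘ⁿ j) z ∈ orbit x
  orbit-closed-∘ⁿ zero    σᵖx≡x z∈orbit = z∈orbit
  orbit-closed-∘ⁿ (suc j) σᵖx≡x z∈orbit = orbit-closed σᵖx≡x (orbit-closed-∘ⁿ j σᵖx≡x z∈orbit)

  orbit-reflects : ∀ {x z} → Periodic x → Periodic z → σ z ∈ orbit x → z ∈ orbit x
  orbit-reflects {x} σᵖx≡x σᵖz≡z σz∈orbit =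
    subst (_∈ orbit x) (σᵖ⁻¹∘σ σᵖz≡z) (orbit-closed-∘ⁿ (p ∸ 1) σᵖx≡x σz∈orbit)

  orbit-moves : ∀ {x z} → Periodic x → ¬ Fixed x → z ∈ orbit x → ¬ Fixed z
  orbit-moves σᵖx≡x x-moves z∈orbit z-fixed with ∈-orbit⁻ z∈orbit
  ... | k , k<p , refl = x-moves (fixed-of-fixed-iterate k (ℕ.<⇒≤ k<p) σᵖx≡x z-fixed)

  Closed : List X → Set
  Closed xs = ∀ {y} → y ∈ xs → σ y ∈ xs

  closed-∘ⁿ : ∀ {xs y} j → Closed xs → y ∈ xs → (σ ∘ⁿ j) y ∈ xs
  closed-∘ⁿ zero    closed y∈xs = y∈xs
  closed-∘ⁿ (suc j) closed y∈xs = closed (closed-∘ⁿ j closed y∈xs)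

  closed-tail : ∀ {x xs} → Fixed x → Unique (x ∷ xs) → All Periodic xs → Closed (x ∷ xs) → Closed xs
  closed-tail {x} x-fixed (x∉xs ∷ _) xs-periodic closed {y} y∈xs with closed (there y∈xs)
  ... | there σy∈xs = σy∈xs
  ... | here σy≡x   = ⊥-elim (All.lookup x∉xs y∈xs (sym y≡x))
    where
    y≡x : y ≡ x
    y≡x = trans (sym (σᵖ⁻¹∘σ (All.lookup xs-periodic y∈xs)))
                (trans (cong (σ ∘ⁿ (p ∸ 1)) σy≡x) (∘ⁿ-fixed σ (p ∸ 1) x-fixed))

  ∉orbit? : (x : X) → Decidable (_∉ orbit x)
  ∉orbit? x z = ¬? (z ∈? orbit x)

  without-orbit-shorter : ∀ x xs → length (filter (∉orbit? x) (x ∷ xs)) ≤ length xs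
  without-orbit-shorter x xs = subst (λ ys → length ys ≤ length xs)
    (sym (List.filter-reject (∉orbit? x) (λ x∉orbit → x∉orbit (∈-orbit⁺ 0<p)))) (List.length-filter (∉orbit? x) xs)

  without-orbit-closed : ∀ {x xs} → Periodic x → All Periodic xs → Closed xs → Closed (filter (∉orbit? x) xs)
  without-orbit-closed {x} σᵖx≡x periodic closed y∈rest with ∈.∈-filter⁻ (∉orbit? x) y∈rest
  ... | y∈xs , y∉orbit = ∈.∈-filter⁺ (∉orbit? x) (closed y∈xs)
                           (λ σy∈orbit → y∉orbit (orbit-reflects σᵖx≡x (All.lookup periodic y∈xs) σy∈orbit))

  fixed-without-orbit : ∀ {x} → Periodic x → ¬ Fixed x →
                        ∀ xs → filter fixed? (filter (∉orbit? x) xs) ≡ filter fixed? xs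
  fixed-without-orbit {x} σᵖx≡x x-moves =
    filter-filter fixed? (∉orbit? x) (λ z-fixed z∈orbit → orbit-moves σᵖx≡x x-moves z∈orbit z-fixed)

  filter-∈orbit-↭ : ∀ {x xs} → Periodic x → ¬ Fixed x → Unique xs → Closed xs → x ∈ xs →
                    filter (_∈? orbit x) xs ↭ orbit x
  filter-∈orbit-↭ {x} {xs} σᵖx≡x x-moves xs! closed x∈xs =
    unique-sameElements⇒↭ (Unique.filter⁺ (_∈? orbit x) xs!) (orbit-unique σᵖx≡x x-moves)
      (mk⇔ (proj₂ ∘ ∈.∈-filter⁻ (_∈? orbit x) {xs = xs})
           (λ z∈orbit → ∈.∈-filter⁺ (_∈? orbit x) (orbit⊆xs z∈orbit) z∈orbit))
    where
    orbit⊆xs : ∀ {z} → z ∈ orbit x → z ∈ xs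
    orbit⊆xs z∈orbit with ∈-orbit⁻ z∈orbit
    ... | k , _ , refl = closed-∘ⁿ k closed x∈xs

  module _ (w : X → ℤ) (w-invariant : ∀ x → w (σ x) ≡ w x) where

    w-∘ⁿ : ∀ k x → w ((σ ∘ⁿ k) x) ≡ w x
    w-∘ⁿ zero    x = refl
    w-∘ⁿ (suc k) x = trans (w-invariant _) (w-∘ⁿ k x)

    sumMap-orbit : ∀ x → sumMap w (orbit x) ≡ + p ℤ.* w x
    sumMap-orbit x = trans (sumMap-const w (w x) {orbit x} (All.tabulate⁺ (λ i → w-∘ⁿ (toℕ i) x)))
                           (cong (λ n → + n ℤ.* w x) (List.length-tabulate {n = p} (λ i → (σ ∘ⁿ toℕ i) x)))

    sumMap-remove-orbit : ∀ {x xs} → Periodic x → ¬ Fixed x → Unique xs → Closed xs → x ∈ xs →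
                          sumMap w xs ≡ + p ℤ.* w x + sumMap w (filter (∉orbit? x) xs)
    sumMap-remove-orbit {x} {xs} σᵖx≡x x-moves xs! closed x∈xs = trans (sumMap-partition (_∈? orbit x) w xs)
      (cong (_+ sumMap w (filter (∉orbit? x) xs))
            (trans (sumMap-↭ w (filter-∈orbit-↭ σᵖx≡x x-moves xs! closed x∈xs)) (sumMap-orbit x)))

    -- Induction on the length: a fixed head is peeled off, otherwise the whole orbit of the head,
    -- which has exactly p elements, is removed.
    sumMap≡sumMap-fixed : ∀ {xs} → Unique xs → Closed xs → All Periodic xs →
                          sumMap w xs ≡ sumMap w (filter fixed? xs) mod p
    sumMap≡sumMap-fixed {xs} = bounded (length xs) ℕ.≤-refl
      where
      bounded : ∀ fuel {xs} → length xs ≤ fuel → Unique xs → Closed xs → All Periodic xs →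
                sumMap w xs ≡ sumMap w (filter fixed? xs) mod p
      bounded _          {[]}     _                 _                _      _ = ≡mod-refl
      bounded (suc fuel) {x ∷ xs} (ℕ.s≤s len≤fuel) xs!@(_ ∷ tail!) closed periodic@(σᵖx≡x ∷ tail-periodic)
        with fixed? x
      ... | yes x-fixed =
        ≡mod-+ˡ (w x) (bounded fuel len≤fuel tail! (closed-tail x-fixed xs! tail-periodic closed) tail-periodic)
      ... | no x-moves = subst₂ (λ a b → a ≡ b mod p)
        (sym (sumMap-remove-orbit σᵖx≡x x-moves xs! closed (here refl)))
        (cong (sumMap w) (trans (fixed-without-orbit σᵖx≡x x-moves (x ∷ xs)) (List.filter-reject fixed? x-moves)))
        (≡mod-+-multiple (w x) (bounded fuel (ℕ.≤-trans (without-orbit-shorter x xs) len≤fuel)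
                                        (Unique.filter⁺ (∉orbit? x) xs!) (without-orbit-closed σᵖx≡x periodic closed)
                                        (All.filter⁺ (∉orbit? x) periodic)))

permute : ∀ {n} → (Fin n → Fin n) → Subset n → Subset n
permute π A = Vec.tabulate (lookup A ∘ π)

lookup-permute : ∀ {n} (π : Fin n → Fin n) (A : Subset n) (i : Fin n) → lookup (permute π A) i ≡ lookup A (π i)
lookup-permute π A = Vec.lookup∘tabulate (lookup A ∘ π)

lookup-ext : ∀ {n} {A B : Subset n} → (∀ i → lookup A i ≡ lookup B i) → A ≡ B
lookup-ext {A = A} {B} A≗B = trans (sym (Vec.tabulate∘lookup A)) (trans (Vec.tabulate-cong A≗B) (Vec.tabulate∘lookup B))

∣p∣≡sum : ∀ {n} (A : Subset n) → ∣ A ∣ ≡ sum (tabulate (λ i → if lookup A i then 1 else 0))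
∣p∣≡sum []          = refl
∣p∣≡sum (true ∷ A)  = cong suc (∣p∣≡sum A)
∣p∣≡sum (false ∷ A) = ∣p∣≡sum A

module Permutation {n : ℕ} (π : Fin n → Fin n)
                   (π-injective : ∀ {i j} → π i ≡ π j → i ≡ j) (π-surjective : ∀ j → ∃[ i ] π i ≡ j) where

  map-allFin-↭ : map π (allFin n) ↭ allFin n
  map-allFin-↭ = unique-sameElements⇒↭ (Unique.map⁺ π-injective (Unique.allFin⁺ n)) (Unique.allFin⁺ n)
                                       (λ {j} → mk⇔ (λ _ → ∈.∈-allFin j) (λ _ → ∈-map-π j))
    where
    ∈-map-π : ∀ j → j ∈ map π (allFin n)
    ∈-map-π j with π-surjective j
    ... | i , refl = ∈.∈-map⁺ π (∈.∈-allFin i)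

  foldr-map-∘-permutation : {A : Set} {_∙_ : A → A → A} {ε : A} → IsCommutativeMonoid _≡_ _∙_ ε →
    (g : Fin n → A) → foldr _∙_ ε (map (g ∘ π) (allFin n)) ≡ foldr _∙_ ε (map g (allFin n))
  foldr-map-∘-permutation {A} isCommutativeMonoid g = trans (cong (foldr _ _) (List.map-∘ (allFin n)))
    (foldr-commMonoid (≡.setoid A) isCommutativeMonoid (↭⇒↭ₛ (↭.map⁺ g map-allFin-↭)))

  ∣permute∣ : (A : Subset n) → ∣ permute π A ∣ ≡ ∣ A ∣
  ∣permute∣ A = begin
    ∣ permute π A ∣
      ≡⟨ ∣p∣≡sum (permute π A) ⟩
    sum (tabulate (indicator ∘ lookup (permute π A)))
      ≡⟨ cong sum (List.tabulate-cong (cong indicator ∘ lookup-permute π A)) ⟩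
    sum (tabulate (indicator ∘ lookup A ∘ π))
      ≡⟨ cong sum (sym (List.map-tabulate id (indicator ∘ lookup A ∘ π))) ⟩
    sum (map (indicator ∘ lookup A ∘ π) (allFin n))
      ≡⟨ foldr-map-∘-permutation ℕ.+-0-isCommutativeMonoid (indicator ∘ lookup A) ⟩
    sum (map (indicator ∘ lookup A) (allFin n))
      ≡⟨ cong sum (List.map-tabulate id (indicator ∘ lookup A)) ⟩
    sum (tabulate (indicator ∘ lookup A))
      ≡⟨ sym (∣p∣≡sum A) ⟩
    ∣ A ∣
      ∎
    where
    open ≡-Reasoning
    indicator : Bool → ℕ
    indicator b = if b then 1 else 0

  module _ (S : List ℕ) (π-preserves-adjacency : ∀ i j → adjᵇ n S (π i) (π j) ≡ adjᵇ n S i j) where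

    independentᵇ-permute : (A : Subset n) → independentᵇ n S (permute π A) ≡ independentᵇ n S A
    independentᵇ-permute A = begin
      independentᵇ n S (permute π A)
        ≡⟨ all-cong (λ i → all-cong (compatible-permute i) (allFin n)) (allFin n) ⟩
      all (λ i → all (compatibleᵇ n S A (π i) ∘ π) (allFin n)) (allFin n)
        ≡⟨ all-cong (λ i → foldr-map-∘-permutation Bool.∧-isCommutativeMonoid (compatibleᵇ n S A (π i)))
                    (allFin n) ⟩
      all ((λ i → all (compatibleᵇ n S A i) (allFin n)) ∘ π) (allFin n)
        ≡⟨ foldr-map-∘-permutation Bool.∧-isCommutativeMonoid (λ i → all (compatibleᵇ n S A i) (allFin n)) ⟩
      independentᵇ n S A
        ∎
      where
      open ≡-Reasoning
      compatible-permute : ∀ i j → compatibleᵇ n S (permute π A) i j ≡ compatibleᵇ n S A (π i) (π j)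
      compatible-permute i j = cong₂ (λ a b → not (a ∧ b)) (lookup-permute π A i)
                                     (cong₂ _∧_ (lookup-permute π A j) (sym (π-preserves-adjacency i j)))
      all-cong : {Y : Set} {f g : Y → Bool} → (∀ y → f y ≡ g y) → ∀ ys → all f ys ≡ all g ys
      all-cong f≗g ys = cong and (List.map-cong f≗g ys)

    weight-permute : (A : Subset n) → weight n S (permute π A) ≡ weight n S A
    weight-permute A = cong₂ (λ b c → if b then sgn c else + 0) (independentᵇ-permute A) (∣permute∣ A)

-- The rotation i ↦ i + 1 of ℤ_(suc m)

module Rotation (m : ℕ) where

  n : ℕ
  n = suc m

  next : Fin n → Fin n
  next i with suc (toℕ i) ℕ.<? n
  ... | yes 1+i<n = fromℕ< 1+i<n
  ... | no  _     = Fin.zero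

  Step : ℕ → ℕ → Set
  Step a a′ = (a < m × a′ ≡ suc a) ⊎ (a ≡ m × a′ ≡ 0)

  next-step : ∀ i → Step (toℕ i) (toℕ (next i))
  next-step i with suc (toℕ i) ℕ.<? n
  ... | yes 1+i<n = inj₁ (ℕ.s≤s⁻¹ 1+i<n , Fin.toℕ-fromℕ< 1+i<n)
  ... | no  1+i≮n = inj₂ (ℕ.≤-antisym (ℕ.s≤s⁻¹ (Fin.toℕ<n i)) (ℕ.s≤s⁻¹ (ℕ.≮⇒≥ 1+i≮n)) , refl)

  toℕ-next : ∀ i → toℕ (next i) ≡ suc (toℕ i) % n
  toℕ-next i with next-step i
  ... | inj₁ (i<m , next≡) = trans next≡ (sym (ℕ.m<n⇒m%n≡m (ℕ.s≤s i<m)))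
  ... | inj₂ (i≡m , next≡) = trans next≡ (sym (trans (cong (λ a → suc a % n) i≡m) (ℕ.n%n≡0 n)))

  next-injective : ∀ {i j} → next i ≡ next j → i ≡ j
  next-injective {i} {j} next-i≡next-j with next-step i | next-step j | cong toℕ next-i≡next-j
  ... | inj₁ (_ , eqi) | inj₁ (_ , eqj) | eq = Fin.toℕ-injective (ℕ.suc-injective (trans (sym eqi) (trans eq eqj)))
  ... | inj₁ (_ , eqi) | inj₂ (_ , eqj) | eq = ⊥-elim (ℕ.1+n≢0 (trans (sym eqi) (trans eq eqj)))
  ... | inj₂ (_ , eqi) | inj₁ (_ , eqj) | eq = ⊥-elim (ℕ.1+n≢0 (trans (sym eqj) (trans (sym eq) eqi)))
  ... | inj₂ (i≡m , _) | inj₂ (j≡m , _) | _  = Fin.toℕ-injective (trans i≡m (sym j≡m))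

  next-surjective : ∀ j → ∃[ i ] next i ≡ j
  next-surjective Fin.zero    = Fin.fromℕ m , Fin.toℕ-injective (trans (toℕ-next (Fin.fromℕ m))
    (trans (cong (λ a → suc a % n) (Fin.toℕ-fromℕ m)) (ℕ.n%n≡0 n)))
  next-surjective (Fin.suc j) = Fin.inject₁ j , Fin.toℕ-injective (trans (toℕ-next (Fin.inject₁ j))
    (trans (cong (λ a → suc a % n) (Fin.toℕ-inject₁ j)) (ℕ.m<n⇒m%n≡m (ℕ.s≤s (Fin.toℕ<n j)))))

  circ : ℕ → ℕ
  circ d = d ⊓ (n ∸ d)

  circ-∸ : ∀ {d} → d ≤ n → circ (n ∸ d) ≡ circ d
  circ-∸ {d} d≤n = trans (cong ((n ∸ d) ⊓_) (ℕ.m∸[m∸n]≡n d≤n)) (ℕ.⊓-comm (n ∸ d) d)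

  circ-wrap : ∀ {b} → b < m → circ (suc b) ≡ circ ∣ b - m ∣
  circ-wrap {b} b<m = begin
    circ (suc b)          ≡⟨ cong circ (sym n∸[m∸b]≡1+b) ⟩
    circ (n ∸ (m ∸ b))    ≡⟨ circ-∸ (ℕ.≤-trans (ℕ.m∸n≤m m b) (ℕ.n≤1+n m)) ⟩
    circ (m ∸ b)          ≡⟨ cong circ (sym (ℕ.m≤n⇒∣m-n∣≡n∸m (ℕ.<⇒≤ b<m))) ⟩
    circ ∣ b - m ∣        ∎
    where
    open ≡-Reasoning
    n∸[m∸b]≡1+b : n ∸ (m ∸ b) ≡ suc b
    n∸[m∸b]≡1+b = trans (ℕ.+-∸-assoc 1 (ℕ.m∸n≤m m b)) (cong suc (ℕ.m∸[m∸n]≡n (ℕ.<⇒≤ b<m)))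

  circ-step : ∀ {a a′ b b′} → Step a a′ → Step b b′ → circ ∣ b′ - a′ ∣ ≡ circ ∣ b - a ∣
  circ-step     (inj₁ (_ , refl))    (inj₁ (_ , refl))    = refl
  circ-step     (inj₂ (refl , refl)) (inj₁ (b<m , refl))  = circ-wrap b<m
  circ-step {a} (inj₁ (a<m , refl))  (inj₂ (refl , refl)) = trans (circ-wrap a<m) (cong circ (ℕ.∣-∣-comm a m))
  circ-step     (inj₂ (refl , refl)) (inj₂ (refl , refl)) = cong circ (sym (ℕ.∣n-n∣≡0 m))

  circDist-next : ∀ i j → circDist n (next i) (next j) ≡ circDist n i j
  circDist-next i j = circ-step (next-step i) (next-step j)

  toℕ-next∘ⁿ : ∀ k i → toℕ ((next ∘ⁿ k) i) ≡ (toℕ i ℕ.+ k) % n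
  toℕ-next∘ⁿ zero    i = trans (sym (ℕ.m<n⇒m%n≡m (Fin.toℕ<n i))) (cong (_% n) (sym (ℕ.+-identityʳ (toℕ i))))
  toℕ-next∘ⁿ (suc k) i = begin
    toℕ (next ((next ∘ⁿ k) i))              ≡⟨ toℕ-next ((next ∘ⁿ k) i) ⟩
    suc (toℕ ((next ∘ⁿ k) i)) % n           ≡⟨ cong (λ a → suc a % n) (toℕ-next∘ⁿ k i) ⟩
    suc ((toℕ i ℕ.+ k) % n) % n             ≡⟨ ℕ.%-distribˡ-+ 1 ((toℕ i ℕ.+ k) % n) n ⟩
    (1 % n ℕ.+ (toℕ i ℕ.+ k) % n % n) % n   ≡⟨ cong (λ a → (1 % n ℕ.+ a) % n) (ℕ.m%n%n≡m%n (toℕ i ℕ.+ k) n) ⟩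
    (1 % n ℕ.+ (toℕ i ℕ.+ k) % n) % n       ≡⟨ sym (ℕ.%-distribˡ-+ 1 (toℕ i ℕ.+ k) n) ⟩
    suc (toℕ i ℕ.+ k) % n                   ≡⟨ cong (_% n) (sym (ℕ.+-suc (toℕ i) k)) ⟩
    (toℕ i ℕ.+ suc k) % n                   ∎
    where open ≡-Reasoning

  next∘ⁿn : ∀ i → (next ∘ⁿ n) i ≡ i
  next∘ⁿn i = Fin.toℕ-injective
    (trans (toℕ-next∘ⁿ n i) (trans (ℕ.[m+n]%n≡m%n (toℕ i) n) (ℕ.m<n⇒m%n≡m (Fin.toℕ<n i))))

  rotate : Subset n → Subset n
  rotate = permute next

  ∣rotate∣ : (A : Subset n) → ∣ rotate A ∣ ≡ ∣ A ∣
  ∣rotate∣ = Permutation.∣permute∣ next next-injective next-surjective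

  weight-rotate : (S : List ℕ) (A : Subset n) → weight n S (rotate A) ≡ weight n S A
  weight-rotate S = Permutation.weight-permute next next-injective next-surjective S
                      (λ i j → cong (λ d → memᵇ d S) (circDist-next i j))

  weight-rotate∘ⁿ : (S : List ℕ) (k : ℕ) (A : Subset n) → weight n S ((rotate ∘ⁿ k) A) ≡ weight n S A
  weight-rotate∘ⁿ S zero    A = refl
  weight-rotate∘ⁿ S (suc k) A = trans (weight-rotate S ((rotate ∘ⁿ k) A)) (weight-rotate∘ⁿ S k A)

  lookup-rotate∘ⁿ : ∀ k A i → lookup ((rotate ∘ⁿ k) A) i ≡ lookup A ((next ∘ⁿ k) i)
  lookup-rotate∘ⁿ zero    A i = refl
  lookup-rotate∘ⁿ (suc k) A i = begin
    lookup (rotate ((rotate ∘ⁿ k) A)) i   ≡⟨ lookup-permute next ((rotate ∘ⁿ k) A) i ⟩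
    lookup ((rotate ∘ⁿ k) A) (next i)     ≡⟨ lookup-rotate∘ⁿ k A (next i) ⟩
    lookup A ((next ∘ⁿ k) (next i))       ≡⟨ cong (lookup A) (∘ⁿ-comm next k 1 i) ⟩
    lookup A (next ((next ∘ⁿ k) i))       ∎
    where open ≡-Reasoning

  rotate∘ⁿn : ∀ A → (rotate ∘ⁿ n) A ≡ A
  rotate∘ⁿn A = lookup-ext (λ i → trans (lookup-rotate∘ⁿ n A i) (cong (lookup A) (next∘ⁿn i)))

isEven : ℕ → Bool
isEven zero    = true
isEven (suc a) = not (isEven a)

isEven-+ : ∀ a b → isEven (a ℕ.+ b) ≡ (if isEven a then isEven b else not (isEven b))
isEven-+ zero    b = refl
isEven-+ (suc a) b rewrite isEven-+ a b with isEven a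
... | true  = refl
... | false = Bool.not-involutive (isEven b)

isEven-* : ∀ a b → isEven (a * b) ≡ isEven a ∨ isEven b
isEven-* zero    b = refl
isEven-* (suc a) b rewrite isEven-+ b (a * b) | isEven-* a b with isEven a | isEven b
... | true  | true  = refl
... | true  | false = refl
... | false | true  = refl
... | false | false = refl

isEven-2* : ∀ a → isEven (2 * a) ≡ true
isEven-2* a = isEven-* 2 a

isEven-^ : ∀ {a} k → isEven a ≡ false → isEven (a ^ k) ≡ false
isEven-^ zero    _ = refl
isEven-^ {a} (suc k) a-odd = trans (isEven-* a (a ^ k)) (cong₂ _∨_ a-odd (isEven-^ k a-odd))

isEven⇒2∣ : ∀ a → isEven a ≡ true → 2 ∣ a
isEven⇒2∣ zero          _      = 2 ∣0
isEven⇒2∣ (suc (suc a)) a+2-even =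
  ∣m∣n⇒∣m+n (∣-refl {2}) (isEven⇒2∣ a (trans (sym (Bool.not-involutive (isEven a))) a+2-even))

odd-prime : ∀ {p} → Prime p → 2 < p → isEven p ≡ false
odd-prime {p} p-prime 2<p with isEven p in p-even
... | false = refl
... | true with prime⇒irreducible p-prime (isEven⇒2∣ p p-even)
...   | inj₁ ()
...   | inj₂ 2≡p = ⊥-elim (ℕ.<-irrefl 2≡p 2<p)

sgn-odd : ∀ a → isEven a ≡ false → sgn a ≡ + 1
sgn-odd (suc zero)    _     = refl
sgn-odd (suc (suc a)) a-odd = sgn-odd a (trans (sym (Bool.not-involutive (isEven a))) a-odd)

-- Subsets fixed by the rotation by two

module Alternating (m : ℕ) (n-even : isEven (suc (suc m)) ≡ true) where

  open Rotation (suc m)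

  alternating : Bool → Bool → Subset n
  alternating a b = Vec.tabulate (λ i → if isEven (toℕ i) then a else b)

  lookup-alternating : ∀ a b i → lookup (alternating a b) i ≡ (if isEven (toℕ i) then a else b)
  lookup-alternating a b = Vec.lookup∘tabulate _

  isEven-next : ∀ i → isEven (toℕ (next i)) ≡ not (isEven (toℕ i))
  isEven-next i with next-step i
  ... | inj₁ (_ , next≡) = cong isEven next≡
  ... | inj₂ (i≡m , next≡) = trans (cong isEven next≡) (sym (trans (cong (not ∘ isEven) i≡m) n-even))

  rotate-alternating : ∀ a b → rotate (alternating a b) ≡ alternating b a
  rotate-alternating a b = lookup-ext λ i → begin
    lookup (rotate (alternating a b)) i              ≡⟨ lookup-permute next (alternating a b) i ⟩
    lookup (alternating a b) (next i)                ≡⟨ lookup-alternating a b (next i) ⟩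
    (if isEven (toℕ (next i)) then a else b)         ≡⟨ cong (if_then a else b) (isEven-next i) ⟩
    (if not (isEven (toℕ i)) then a else b)          ≡⟨ Bool.if-not (isEven (toℕ i)) ⟩
    (if isEven (toℕ i) then b else a)                ≡⟨ sym (lookup-alternating b a i) ⟩
    lookup (alternating b a) i                       ∎
    where open ≡-Reasoning

  rotate²-alternating : ∀ a b → (rotate ∘ⁿ 2) (alternating a b) ≡ alternating a b
  rotate²-alternating a b = trans (cong rotate (rotate-alternating a b)) (rotate-alternating b a)

  rotate²-fixed⇒alternating : ∀ A → (rotate ∘ⁿ 2) A ≡ A →
                              A ≡ alternating (lookup A Fin.zero) (lookup A (Fin.suc Fin.zero))
  rotate²-fixed⇒alternating A fixed = lookup-ext λ i → begin
    lookup A i                               ≡⟨ cong (lookup A) (sym (Fin.fromℕ<-toℕ i (Fin.toℕ<n i))) ⟩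
    lookup A (fromℕ< (Fin.toℕ<n i))          ≡⟨ by-parity (toℕ i) (Fin.toℕ<n i) ⟩
    (if isEven (toℕ i) then A₀ else A₁)       ≡⟨ sym (lookup-alternating A₀ A₁ i) ⟩
    lookup (alternating A₀ A₁) i             ∎
    where
    open ≡-Reasoning
    A₀ = lookup A Fin.zero
    A₁ = lookup A (Fin.suc Fin.zero)
    by-parity : ∀ a (a<n : a < n) → lookup A (fromℕ< a<n) ≡ (if isEven a then A₀ else A₁)
    by-parity zero          _   = refl
    by-parity (suc zero)    _   = refl
    by-parity (suc (suc a)) a+2<n = begin
      lookup A (fromℕ< a+2<n)                      ≡⟨ cong (lookup A) (Fin.toℕ-injective toℕ-shift) ⟩
      lookup A ((next ∘ⁿ 2) (fromℕ< a<n))          ≡⟨ sym (lookup-rotate∘ⁿ 2 A (fromℕ< a<n)) ⟩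
      lookup ((rotate ∘ⁿ 2) A) (fromℕ< a<n)        ≡⟨ cong (λ B → lookup B (fromℕ< a<n)) fixed ⟩
      lookup A (fromℕ< a<n)                        ≡⟨ by-parity a a<n ⟩
      (if isEven a then A₀ else A₁)
        ≡⟨ cong (if_then A₀ else A₁) (sym (Bool.not-involutive (isEven a))) ⟩
      (if isEven (suc (suc a)) then A₀ else A₁)    ∎
      where
      a<n : a < n
      a<n = ℕ.<-trans (ℕ.n<1+n a) (ℕ.<-trans (ℕ.n<1+n (suc a)) a+2<n)
      toℕ-shift : toℕ (fromℕ< a+2<n) ≡ toℕ ((next ∘ⁿ 2) (fromℕ< a<n))
      toℕ-shift = sym (begin
        toℕ ((next ∘ⁿ 2) (fromℕ< a<n))          ≡⟨ toℕ-next∘ⁿ 2 (fromℕ< a<n) ⟩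
        (toℕ (fromℕ< a<n) ℕ.+ 2) % n            ≡⟨ cong (λ b → (b ℕ.+ 2) % n) (Fin.toℕ-fromℕ< a<n) ⟩
        (a ℕ.+ 2) % n                           ≡⟨ cong (_% n) (ℕ.+-comm a 2) ⟩
        suc (suc a) % n                         ≡⟨ ℕ.m<n⇒m%n≡m a+2<n ⟩
        suc (suc a)                             ≡⟨ sym (Fin.toℕ-fromℕ< a+2<n) ⟩
        toℕ (fromℕ< a+2<n)                      ∎)

  alternating₂ : Subset 2 → Subset n
  alternating₂ v = alternating (lookup v Fin.zero) (lookup v (Fin.suc Fin.zero))

  alternating₂-injective : ∀ {v w} → alternating₂ v ≡ alternating₂ w → v ≡ w
  alternating₂-injective {_ ∷ _ ∷ []} {_ ∷ _ ∷ []} eq =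
    cong₂ (λ a b → a ∷ b ∷ []) (cong (λ A → lookup A Fin.zero) eq) (cong (λ A → lookup A (Fin.suc Fin.zero)) eq)

  alternatings : List (Subset n)
  alternatings = map alternating₂ (allSubsets 2)

  rotate²-fixed? : Decidable (λ A → (rotate ∘ⁿ 2) A ≡ A)
  rotate²-fixed? A = Vec.≡-dec Bool._≟_ ((rotate ∘ⁿ 2) A) A

  rotate²-fixed-↭-alternatings : filter rotate²-fixed? (allSubsets n) ↭ alternatings
  rotate²-fixed-↭-alternatings = unique-sameElements⇒↭
    (Unique.filter⁺ rotate²-fixed? (allSubsets-unique n))
    (Unique.map⁺ alternating₂-injective (allSubsets-unique 2))
    (mk⇔ fixed⇒∈alternatings ∈alternatings⇒fixed)
    where
    fixed⇒∈alternatings : ∀ {A} → A ∈ filter rotate²-fixed? (allSubsets n) → A ∈ alternatings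
    fixed⇒∈alternatings {A} A∈fixed =
      subst (_∈ alternatings)
            (sym (rotate²-fixed⇒alternating A (proj₂ (∈.∈-filter⁻ rotate²-fixed? {xs = allSubsets n} A∈fixed))))
            (∈.∈-map⁺ alternating₂ (∈-allSubsets (lookup A Fin.zero ∷ lookup A (Fin.suc Fin.zero) ∷ [])))
    ∈alternatings⇒fixed : ∀ {A} → A ∈ alternatings → A ∈ filter rotate²-fixed? (allSubsets n)
    ∈alternatings⇒fixed A∈alternatings with ∈.∈-map⁻ alternating₂ {xs = allSubsets 2} A∈alternatings
    ... | v , _ , refl = ∈.∈-filter⁺ rotate²-fixed? (∈-allSubsets (alternating₂ v))
                           (rotate²-alternating (lookup v Fin.zero) (lookup v (Fin.suc Fin.zero)))

  2*∣alternating∣≡n : 2 * ∣ alternating true false ∣ ≡ n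
  2*∣alternating∣≡n = begin
    2 * c                       ≡⟨ cong (c ℕ.+_) (ℕ.+-identityʳ c) ⟩
    c ℕ.+ c                     ≡⟨ cong (c ℕ.+_) c≡n∸c ⟩
    c ℕ.+ (n ∸ c)               ≡⟨ ℕ.m+[n∸m]≡n (∣p∣≤n (alternating true false)) ⟩
    n                           ∎
    where
    open ≡-Reasoning
    c = ∣ alternating true false ∣
    complement : alternating false true ≡ ∁ (alternating true false)
    complement = lookup-ext λ i → begin
      lookup (alternating false true) i              ≡⟨ lookup-alternating false true i ⟩
      (if isEven (toℕ i) then false else true)       ≡⟨ sym (Bool.if-float not (isEven (toℕ i))) ⟩
      not (if isEven (toℕ i) then true else false)   ≡⟨ cong not (sym (lookup-alternating true false i)) ⟩
      not (lookup (alternating true false) i)        ≡⟨ sym (Vec.lookup-map i not (alternating true false)) ⟩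
      lookup (∁ (alternating true false)) i          ∎
    c≡n∸c : c ≡ n ∸ c
    c≡n∸c = begin
      c                                   ≡⟨ sym (∣rotate∣ (alternating true false)) ⟩
      ∣ rotate (alternating true false) ∣ ≡⟨ cong ∣_∣ (trans (rotate-alternating true false) complement) ⟩
      ∣ ∁ (alternating true false) ∣      ≡⟨ ∣∁p∣≡n∸∣p∣ (alternating true false) ⟩
      n ∸ c                               ∎

  module _ (S : List ℕ) where

    weight-alternating-false-false : weight n S (alternating false false) ≡ - + 1
    weight-alternating-false-false =
      cong₂ (λ b c → if b then sgn c else + 0) (empty-independent S (alternating false false) empty) ∣∅∣≡0
      where
      empty : ∀ i → lookup (alternating false false) i ≡ false
      empty i = trans (lookup-alternating false false i) (Bool.if-eta (isEven (toℕ i)))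
      ∣∅∣≡0 : ∣ alternating false false ∣ ≡ 0
      ∣∅∣≡0 = trans (cong ∣_∣ (lookup-ext {A = alternating false false} {B = ∅}
                                           λ i → trans (empty i) (sym (Vec.lookup-replicate i false))))
                    (∣⊥∣≡0 n)

    weight-alternating-true-true : ∀ {s} → 0 < s → 2 * s ≤ n → memᵇ s S ≡ true →
                                   weight n S (alternating true true) ≡ + 0
    weight-alternating-true-true {s} 0<s 2s≤n s∈S =
      cong (if_then sgn ∣ alternating true true ∣ else + 0)
           (adjacent-not-independent S (alternating true true) Fin.zero (fromℕ< s<n) (full Fin.zero) (full (fromℕ< s<n)) 0~s)
      where
      full : ∀ i → lookup (alternating true true) i ≡ true
      full i = trans (lookup-alternating true true i) (Bool.if-eta (isEven (toℕ i)))
      s≤n∸s : s ≤ n ∸ s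
      s≤n∸s = ℕ.m+n≤o⇒m≤o∸n s (subst (_≤ n) (cong (s ℕ.+_) (ℕ.+-identityʳ s)) 2s≤n)
      s<n : s < n
      s<n = ℕ.<-≤-trans (ℕ.m<m+n s 0<s) (subst (_≤ n) (cong (s ℕ.+_) (ℕ.+-identityʳ s)) 2s≤n)
      0~s : adjᵇ n S Fin.zero (fromℕ< s<n) ≡ true
      0~s = begin
        memᵇ (∣ toℕ (fromℕ< s<n) - 0 ∣ ⊓ (n ∸ ∣ toℕ (fromℕ< s<n) - 0 ∣)) S
          ≡⟨ cong (λ d → memᵇ (d ⊓ (n ∸ d)) S) (trans (ℕ.∣-∣-identityʳ _) (Fin.toℕ-fromℕ< s<n)) ⟩
        memᵇ (s ⊓ (n ∸ s)) S    ≡⟨ cong (λ d → memᵇ d S) (ℕ.m≤n⇒m⊓n≡m s≤n∸s) ⟩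
        memᵇ s S                ≡⟨ s∈S ⟩
        true                    ∎
        where open ≡-Reasoning

    weight-alternating-false-true : weight n S (alternating false true) ≡ weight n S (alternating true false)
    weight-alternating-false-true =
      trans (cong (weight n S) (sym (rotate-alternating true false))) (weight-rotate S (alternating true false))

    weight-alternating-true-false : isEven ∣ alternating true false ∣ ≡ false →
                                    weight n S (alternating true false) ≡ + 0 ⊎ weight n S (alternating true false) ≡ + 1
    weight-alternating-true-false ∣alternating∣-odd with independentᵇ n S (alternating true false)
    ... | false = inj₁ refl
    ... | true  = inj₂ (sgn-odd ∣ alternating true false ∣ ∣alternating∣-odd)

    ∣sumMap-alternatings∣≡1 : ∀ {s} → 0 < s → 2 * s ≤ n → memᵇ s S ≡ true →
                              isEven ∣ alternating true false ∣ ≡ false →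
                              ℤ.∣ sumMap (weight n S) alternatings ∣ ≡ 1
    ∣sumMap-alternatings∣≡1 0<s 2s≤n s∈S ∣alternating∣-odd
      rewrite weight-alternating-true-true 0<s 2s≤n s∈S | weight-alternating-false-true | weight-alternating-false-false
      with weight n S (alternating true false) | weight-alternating-true-false ∣alternating∣-odd
    ... | _ | inj₁ refl = refl
    ... | _ | inj₂ refl = refl

-- The tower of subsets fixed by ρ^(2p^t)

module Tower (m : ℕ) {p : ℕ} (p-prime : Prime p) (S : List ℕ) where

  open Rotation m

  _≟ₛ_ : DecidableEquality (Subset n)
  _≟ₛ_ = Vec.≡-dec Bool._≟_

  σ : ℕ → Subset n → Subset n
  σ t = rotate ∘ⁿ (2 * p ^ t)

  σ-fixed? : ∀ t → Decidable (λ A → σ t A ≡ A)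
  σ-fixed? t A = σ t A ≟ₛ A

  Fix : ℕ → List (Subset n)
  Fix t = filter (σ-fixed? t) (allSubsets n)

  σ∘ⁿp : ∀ t A → (σ t ∘ⁿ p) A ≡ σ (suc t) A
  σ∘ⁿp t A = trans (sym (∘ⁿ-* rotate p (2 * p ^ t) A)) (cong (λ e → (rotate ∘ⁿ e) A) p*2pᵗ≡2pᵗ⁺¹)
    where
    p*2pᵗ≡2pᵗ⁺¹ : p * (2 * p ^ t) ≡ 2 * p ^ suc t
    p*2pᵗ≡2pᵗ⁺¹ = trans (sym (ℕ.*-assoc p 2 (p ^ t)))
                        (trans (cong (_* p ^ t) (ℕ.*-comm p 2)) (ℕ.*-assoc 2 p (p ^ t)))

  ∈Fix⇒fixed : ∀ {t A} → A ∈ Fix t → σ t A ≡ A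
  ∈Fix⇒fixed {t} = proj₂ ∘ ∈.∈-filter⁻ (σ-fixed? t) {xs = allSubsets n}

  Fix-step : ∀ t → sumMap (weight n S) (Fix (suc t)) ≡ sumMap (weight n S) (Fix t) mod p
  Fix-step t = subst (λ L → sumMap (weight n S) (Fix (suc t)) ≡ sumMap (weight n S) L mod p)
    (filter-filter (σ-fixed? t) (σ-fixed? (suc t)) fixed⇒fixed-suc (allSubsets n))
    (sumMap≡sumMap-fixed (weight n S) (weight-rotate∘ⁿ S (2 * p ^ t))
       (Unique.filter⁺ (σ-fixed? (suc t)) (allSubsets-unique n)) closed (All.tabulate periodic))
    where
    open Orbits _≟ₛ_ (σ t) p-prime using (sumMap≡sumMap-fixed)
    fixed⇒fixed-suc : ∀ {A} → σ t A ≡ A → σ (suc t) A ≡ A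
    fixed⇒fixed-suc {A} fixed = trans (sym (σ∘ⁿp t A)) (∘ⁿ-fixed (σ t) p fixed)
    closed : ∀ {A} → A ∈ Fix (suc t) → σ t A ∈ Fix (suc t)
    closed {A} A∈Fix = ∈.∈-filter⁺ (σ-fixed? (suc t)) (∈-allSubsets (σ t A))
      (trans (∘ⁿ-comm rotate (2 * p ^ suc t) (2 * p ^ t) A) (cong (σ t) (∈Fix⇒fixed {suc t} A∈Fix)))
    periodic : ∀ {A} → A ∈ Fix (suc t) → (σ t ∘ⁿ p) A ≡ A
    periodic {A} A∈Fix = trans (σ∘ⁿp t A) (∈Fix⇒fixed {suc t} A∈Fix)

  Fix-tower : ∀ t → sumMap (weight n S) (Fix t) ≡ sumMap (weight n S) (Fix 0) mod p
  Fix-tower zero    = ≡mod-refl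
  Fix-tower (suc t) = ≡mod-trans (Fix-step t) (Fix-tower t)

  Fix-top : ∀ k → n ≡ 2 * p ^ k → Fix k ≡ allSubsets n
  Fix-top k n≡2pᵏ = List.filter-all (σ-fixed? k) (All.tabulate λ {A} _ →
    trans (cong (λ e → (rotate ∘ⁿ e) A) (sym n≡2pᵏ)) (rotate∘ⁿn A))

redEuler-2pᵏ≢0 : ∀ m {p} k → Prime p → 2 < p → suc (suc m) ≡ 2 * p ^ k →
                 ∀ {s} S → 0 < s → s ≤ p ^ k → redEuler (suc (suc m)) (s ∷ S) ≢ + 0
redEuler-2pᵏ≢0 m {p} k p-prime 2<p n≡2pᵏ {s} S 0<s s≤pᵏ =
  ≡mod-unit⇒≢0 redEuler≡sum-alternatings (∣sumMap-alternatings∣≡1 (s ∷ S) 0<s 2s≤n s∈S ∣alternating∣-odd)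
               (ℕ.<-trans (ℕ.n<1+n 1) 2<p)
  where
  open Rotation (suc m) using (n)
  open Tower (suc m) p-prime (s ∷ S)
  open Alternating m (subst (λ a → isEven a ≡ true) (sym n≡2pᵏ) (isEven-2* (p ^ k)))
  w = weight n (s ∷ S)
  -- Fix 0 computes to filter rotate²-fixed? (allSubsets n), since 2 * p ^ 0 reduces to 2.
  redEuler≡sum-alternatings : redEuler n (s ∷ S) ≡ sumMap w alternatings mod p
  redEuler≡sum-alternatings = subst₂ (λ a b → a ≡ b mod p)
    (sym (trans (redEuler≡sumMap-weight n (s ∷ S)) (cong (sumMap w) (sym (Fix-top k n≡2pᵏ)))))
    (sumMap-↭ w rotate²-fixed-↭-alternatings)
    (Fix-tower k)
  2s≤n : 2 * s ≤ n
  2s≤n = subst (2 * s ≤_) (sym n≡2pᵏ) (ℕ.*-monoʳ-≤ 2 s≤pᵏ)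
  s∈S : memᵇ s (s ∷ S) ≡ true
  s∈S = cong (Bool._∨ memᵇ s S) (Equivalence.to Bool.T-≡ (ℕ.≡⇒≡ᵇ s s refl))
  ∣alternating∣-odd : isEven ∣ alternating true false ∣ ≡ false
  ∣alternating∣-odd = subst (λ a → isEven a ≡ false)
                            (sym (ℕ.*-cancelˡ-≡ _ (p ^ k) 2 (trans 2*∣alternating∣≡n n≡2pᵏ)))
                            (isEven-^ k (odd-prime p-prime 2<p))

theorem2p9 : (p k : ℕ) → Prime p → 2 < p → 0 < k →
    (S : List ℕ) → S ≢ [] → All (λ s → 1 ≤ s × s ≤ p ^ k) S →
    redEuler (2 * p ^ k) S ≢ + 0
theorem2p9 p k p-prime 2<p _ []      S≢[] _                  = ⊥-elim (S≢[] refl)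
theorem2p9 p k p-prime 2<p _ (s ∷ S) _    ((0<s , s≤pᵏ) ∷ _) =
  subst (λ n → redEuler n (s ∷ S) ≢ + 0) n≡2pᵏ
        (redEuler-2pᵏ≢0 (2 * p ^ k ∸ 2) k p-prime 2<p n≡2pᵏ S 0<s s≤pᵏ)
  where
  n≡2pᵏ : suc (suc (2 * p ^ k ∸ 2)) ≡ 2 * p ^ k
  n≡2pᵏ = trans (ℕ.+-comm 2 _) (ℕ.m∸n+n≡m (ℕ.*-monoʳ-≤ 2 (ℕ.m^n>0 p {{prime⇒nonZero p-prime}} k)))
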